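{- Let $V$ be a finite set and let $\mathbf{P}=(\mathbf{p}_v)_{v\in V}$ be a compatible family of $V$-partitions. Then for any three distinct elements $u,v,w\in V$ the following nine assertions are equivalent: (i) $\mathbf{p}_w[u]\neq\mathbf{p}_w[v]$; (ii) $\mathbf{p}_w[u]$ is a proper subset of $\mathbf{p}_v[w]$; (iii) $\mathbf{p}_w[u]$ is a proper subset of $\mathbf{p}_v[u]$; (iv) $\mathbf{p}_w[u]\subseteq\mathbf{p}_v[u]$; (v) $v\notin\mathbf{p}_w[u]$; (vi) $\mathbf{p}_w[v]$ is a proper subset of $\mathbf{p}_u[w]$; (vii) $\mathbf{p}_w[v]$ is a proper subset of $\mathbf{p}_u[v]$; (viii) $\mathbf{p}_w[v]\subseteq\mathbf{p}_u[v]$; (ix) $u\notin\mathbf{p}_w[v]$; and each of them implies (x) $w\in\mathbf{p}_v[u]\cap\mathbf{p}_u[v]$.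
   Context: For a partition $\mathbf{p}$ of a set $V$ and $y\in V$, $\mathbf{p}[y]$ denotes the block of $\mathbf{p}$ containing $y$. A $V$-indexed family $\mathbf{P}=(\mathbf{p}_v)_{v\in V}$ of partitions of $V$ is a compatible family of $V$-partitions if $\{v\}\in\mathbf{p}_v$ for all $v\in V$ and $\mathbf{p}_v[u]\cup\mathbf{p}_u[v]=V$ for any two distinct $u,v\in V$. -}

module Defs where

open import Data.Nat using (ℕ)
open import Data.Fin using (Fin)
open import Data.Fin.Subset using (Subset; _∈_; _∩_; _∪_; ⊤; ⁅_⁆; Nonempty; Empty)
open import Data.List using (List)
open import Data.List.Membership.Propositional renaming (_∈_ to _∈ˡ_)
open import Data.List.Relation.Unary.All using (All)
open import Data.List.Relation.Unary.AllPairs using (AllPairs)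
open import Data.Product using (Σ; _×_; proj₁)
open import Relation.Binary.PropositionalEquality using (_≡_; _≢_)

record Partition (n : ℕ) : Set where
  field
    blocks   : List (Subset n)
    nonempty : All Nonempty blocks
    disjoint : AllPairs (λ A B → Empty (A ∩ B)) blocks
    cover    : (x : Fin n) → Σ (Subset n) (λ B → B ∈ˡ blocks × x ∈ B)

open Partition public

-- p [ y ] : the block of p containing y (unique by disjointness).
_[_] : ∀ {n} → Partition n → Fin n → Subset n
p [ y ] = proj₁ (cover p y)

record Compatible {n : ℕ} (P : Fin n → Partition n) : Set where
  field
    singleton : (v : Fin n) → ⁅ v ⁆ ∈ˡ blocks (P v)
    union     : (u v : Fin n) → u ≢ v → (P v [ u ]) ∪ (P u [ v ]) ≡ ⊤

-- Since p_v[w] ∪ p_w[v] = V, every element of p_w[u] lies in p_v[w] unless p_w[u] = p_w[v];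
-- so v ∉ p_w[u] forces p_w[u] ⊆ p_v[w], hence u ∈ p_v[w] and p_v[w] = p_v[u]. The inclusion is
-- strict because w ∈ p_v[w] while p_w[w] = {w}. Conversely, any inclusion of p_w[u] into a block
-- of p_v other than {v} excludes v from p_w[u]. Exchanging u and v gives the other four assertions.
module Submission where

open import Defs
open import Data.Nat using (ℕ)
open import Data.Fin using (Fin)
open import Data.Fin.Subset using (Subset; _∈_; _∉_; _⊆_; _⊂_; _∩_; ⁅_⁆; Empty)
open import Data.Fin.Subset.Properties using (x∈p∩q⁺; x∈p∪q⁻; ∈⊤; x∈⁅x⁆; x∈⁅y⁆⇒x≡y; p⊂q⇒p⊆q)
open import Data.Product using (_×_; _,_; proj₁; proj₂)
open import Data.Sum using (_⊎_; inj₁; inj₂)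
open import Data.List using (List; _∷_)
open import Data.List.Membership.Propositional using () renaming (_∈_ to _∈ˡ_)
open import Data.List.Relation.Unary.Any using (here; there)
open import Data.List.Relation.Unary.All using (lookup)
open import Data.List.Relation.Unary.AllPairs using (AllPairs; _∷_)
open import Data.Empty using (⊥-elim)
open import Function.Base using (_∘_)
open import Function.Bundles using (_⇔_; mk⇔; module Equivalence)
open import Function.Properties.Equivalence using () renaming (sym to ⇔-sym; trans to ⇔-trans)
open import Relation.Binary.PropositionalEquality using (_≡_; _≢_; refl; sym; trans; subst; ≢-sym)

module _ {n : ℕ} where

  disjoint-∈-unique : {bs : List (Subset n)} → AllPairs (λ A B → Empty (A ∩ B)) bs →
                      ∀ {A B x} → A ∈ˡ bs → B ∈ˡ bs → x ∈ A → x ∈ B → A ≡ B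
  disjoint-∈-unique (_ ∷ _)  (here refl) (here refl) _   _   = refl
  disjoint-∈-unique (d ∷ _)  (here refl) (there B∈) x∈A x∈B = ⊥-elim (lookup d B∈ (_ , x∈p∩q⁺ (x∈A , x∈B)))
  disjoint-∈-unique (d ∷ _)  (there A∈) (here refl) x∈A x∈B = ⊥-elim (lookup d A∈ (_ , x∈p∩q⁺ (x∈B , x∈A)))
  disjoint-∈-unique (_ ∷ ds) (there A∈) (there B∈) x∈A x∈B = disjoint-∈-unique ds A∈ B∈ x∈A x∈B

  module _ (p : Partition n) where

    block∈blocks : (y : Fin n) → p [ y ] ∈ˡ blocks p
    block∈blocks y = proj₁ (proj₂ (cover p y))

    ∈-block : (y : Fin n) → y ∈ p [ y ]
    ∈-block y = proj₂ (proj₂ (cover p y))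

    block-unique : ∀ {B x} → B ∈ˡ blocks p → x ∈ B → p [ x ] ≡ B
    block-unique B∈ x∈B = disjoint-∈-unique (disjoint p) (block∈blocks _) B∈ (∈-block _) x∈B

    ∈⇒block≡ : ∀ {x y} → x ∈ p [ y ] → p [ x ] ≡ p [ y ]
    ∈⇒block≡ = block-unique (block∈blocks _)

    ∈-both⇒block≡ : ∀ {x y z} → x ∈ p [ y ] → x ∈ p [ z ] → p [ y ] ≡ p [ z ]
    ∈-both⇒block≡ x∈y x∈z = trans (sym (∈⇒block≡ x∈y)) (∈⇒block≡ x∈z)

    block≢⇔∉ : (x y : Fin n) → (p [ x ] ≢ p [ y ]) ⇔ (y ∉ p [ x ])
    block≢⇔∉ x y = mk⇔ (λ x≢y y∈x → x≢y (sym (∈⇒block≡ y∈x)))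
                       (λ y∉x x≡y → y∉x (subst (y ∈_) (sym x≡y) (∈-block y)))

module _ {n : ℕ} (P : Fin n → Partition n) (C : Compatible P) where
  open Compatible C

  own-block≡⁅⁆ : (v : Fin n) → P v [ v ] ≡ ⁅ v ⁆
  own-block≡⁅⁆ v = block-unique (P v) (singleton v) (x∈⁅x⁆ v)

  ∉-other-block : ∀ {u v} → u ≢ v → v ∉ P v [ u ]
  ∉-other-block {u} {v} u≢v v∈u =
    u≢v (x∈⁅y⁆⇒x≡y v (subst (u ∈_) (trans (sym (∈⇒block≡ (P v) v∈u)) (own-block≡⁅⁆ v)) (∈-block (P v) u)))

  ∈-block-union : ∀ {u v} → u ≢ v → (x : Fin n) → x ∈ P v [ u ] ⊎ x ∈ P u [ v ]
  ∈-block-union {u} {v} u≢v x = x∈p∪q⁻ (P v [ u ]) (P u [ v ]) (subst (x ∈_) (sym (union u v u≢v)) ∈⊤)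

  ⊆-other-block⇒∉ : ∀ {y v} {A : Subset n} → y ≢ v → A ⊆ P v [ y ] → v ∉ A
  ⊆-other-block⇒∉ y≢v A⊆ v∈A = ∉-other-block y≢v (A⊆ v∈A)

  module _ {u v w : Fin n} (v≢w : v ≢ w) (v∉wu : v ∉ P w [ u ]) where

    ∉⇒⊆-block : P w [ u ] ⊆ P v [ w ]
    ∉⇒⊆-block {x} x∈wu with ∈-block-union (≢-sym v≢w) x
    ... | inj₁ x∈vw = x∈vw
    ... | inj₂ x∈wv = ⊥-elim (v∉wu (subst (v ∈_) (∈-both⇒block≡ (P w) x∈wv x∈wu) (∈-block (P w) v)))

    ∉⇒block≡ : P v [ u ] ≡ P v [ w ]
    ∉⇒block≡ = ∈⇒block≡ (P v) (∉⇒⊆-block (∈-block (P w) u))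

    ∉⇒∈-block : w ∈ P v [ u ]
    ∉⇒∈-block = subst (w ∈_) (sym ∉⇒block≡) (∈-block (P v) w)

  module _ {u v w : Fin n} (u≢v : u ≢ v) (v≢w : v ≢ w) (u≢w : u ≢ w) where

    ⊆-block-u⇒⊂ : (P w [ u ] ⊆ P v [ u ]) → (P w [ u ] ⊂ P v [ u ])
    ⊆-block-u⇒⊂ ⊆u = ⊆u , w , ∉⇒∈-block v≢w (⊆-other-block⇒∉ u≢v ⊆u) , ∉-other-block u≢w

    ⊆-block-u⇔∉ : (P w [ u ] ⊆ P v [ u ]) ⇔ (v ∉ P w [ u ])
    ⊆-block-u⇔∉ = mk⇔ (⊆-other-block⇒∉ u≢v)
                      (λ v∉ → subst (P w [ u ] ⊆_) (sym (∉⇒block≡ v≢w v∉)) (∉⇒⊆-block v≢w v∉))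

    ⊂-block-u⇔∉ : (P w [ u ] ⊂ P v [ u ]) ⇔ (v ∉ P w [ u ])
    ⊂-block-u⇔∉ = mk⇔ (⊆-other-block⇒∉ u≢v ∘ p⊂q⇒p⊆q)
                      (λ v∉ → ⊆-block-u⇒⊂ (Equivalence.from ⊆-block-u⇔∉ v∉))

    ⊂-block-w⇔∉ : (P w [ u ] ⊂ P v [ w ]) ⇔ (v ∉ P w [ u ])
    ⊂-block-w⇔∉ = mk⇔ (⊆-other-block⇒∉ (≢-sym v≢w) ∘ p⊂q⇒p⊆q)
                      (λ v∉ → ∉⇒⊆-block v≢w v∉ , w , ∈-block (P v) w , ∉-other-block u≢w)

lemma1 : {n : ℕ} (P : Fin n → Partition n) → Compatible P →
    (u v w : Fin n) → u ≢ v → v ≢ w → u ≢ w →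
    let i = (P w [ u ]) ≢ (P w [ v ]) in
    (i ⇔ ((P w [ u ]) ⊂ (P v [ w ]))) ×
    (i ⇔ ((P w [ u ]) ⊂ (P v [ u ]))) ×
    (i ⇔ ((P w [ u ]) ⊆ (P v [ u ]))) ×
    (i ⇔ (v ∉ (P w [ u ]))) ×
    (i ⇔ ((P w [ v ]) ⊂ (P u [ w ]))) ×
    (i ⇔ ((P w [ v ]) ⊂ (P u [ v ]))) ×
    (i ⇔ ((P w [ v ]) ⊆ (P u [ v ]))) ×
    (i ⇔ (u ∉ (P w [ v ]))) ×
    (i → w ∈ ((P v [ u ]) ∩ (P u [ v ])))
lemma1 P C u v w u≢v v≢w u≢w =
    via-v (⊂-block-w⇔∉ P C u≢v v≢w u≢w)
  , via-v (⊂-block-u⇔∉ P C u≢v v≢w u≢w)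
  , via-v (⊆-block-u⇔∉ P C u≢v v≢w u≢w)
  , i⇔v∉
  , via-u (⊂-block-w⇔∉ P C (≢-sym u≢v) u≢w v≢w)
  , via-u (⊂-block-u⇔∉ P C (≢-sym u≢v) u≢w v≢w)
  , via-u (⊆-block-u⇔∉ P C (≢-sym u≢v) u≢w v≢w)
  , i⇔u∉
  , λ u≁v → x∈p∩q⁺ ( ∉⇒∈-block P C v≢w (Equivalence.to i⇔v∉ u≁v)
                    , ∉⇒∈-block P C u≢w (Equivalence.to i⇔u∉ u≁v))
  where
  i = P w [ u ] ≢ P w [ v ]
  i⇔v∉ : i ⇔ (v ∉ P w [ u ])
  i⇔v∉ = block≢⇔∉ (P w) u v
  i⇔u∉ : i ⇔ (u ∉ P w [ v ])
  i⇔u∉ = ⇔-trans (mk⇔ ≢-sym ≢-sym) (block≢⇔∉ (P w) v u)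
  via-v : ∀ {Q : Set} → Q ⇔ (v ∉ P w [ u ]) → i ⇔ Q
  via-v Q⇔ = ⇔-trans i⇔v∉ (⇔-sym Q⇔)
  via-u : ∀ {Q : Set} → Q ⇔ (u ∉ P w [ v ]) → i ⇔ Q
  via-u Q⇔ = ⇔-trans i⇔u∉ (⇔-sym Q⇔)
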